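{- Let $F\subseteq T$ be trees, where $F$ is uniquely $3$-$\chi_\rho$-packable, and let $v$ be any vertex of colour $3$ in the unique packing colouring of $F$ with colours $\{1,2,3\}$. Then for any packing colouring $c:V(T)\to\{1,2,3\}$ of $T$, the vertices of $T$ with colour $3$ under $c$ are precisely those vertices whose distance from $v$ in $T$ is a multiple of $4$.
   Context: A set $X\subseteq V(G)$ is an $i$-packing if distinct vertices of $X$ are at distance $>i$. A packing colouring with colours $\{1,\ldots,k\}$ is a map $c:V(G)\to\{1,\ldots,k\}$ with each class $c^{ -1}(i)$ an $i$-packing; $\chi_\rho(G)$ is the least such $k$. $G$ is uniquely $k$-$\chi_\rho$-packable if $\chi_\rho(G)=k$ and there is exactly one packing colouring $V(G)\to\{1,\ldots,k\}$ (colourings compared as functions, not up to permutation of colours). -}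

module Defs where

open import Data.Nat using (ℕ; zero; suc; _≤_; _<_)
open import Data.Fin using (Fin; zero; suc; inject₁; fromℕ)
open import Data.Product using (Σ; ∃; _×_; _,_)
open import Relation.Nullary using (¬_)
open import Relation.Binary.PropositionalEquality using (_≡_; _≢_)
open import Function.Definitions using (Injective)

record Graph (n : ℕ) : Set₁ where
  field
    Adj    : Fin n → Fin n → Set
    sym    : ∀ {x y} → Adj x y → Adj y x
    irrefl : ∀ {x} → ¬ Adj x x
open Graph public

data Walk {n : ℕ} (G : Graph n) : Fin n → Fin n → ℕ → Set where
  nil  : ∀ {x} → Walk G x x 0
  cons : ∀ {x y z k} → Adj G x y → Walk G y z k → Walk G x z (suc k)

Dist : ∀ {n} → Graph n → Fin n → Fin n → ℕ → Set
Dist G u w d = Walk G u w d × (∀ k → Walk G u w k → d ≤ k)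

Connected : ∀ {n} → Graph n → Set
Connected G = ∀ u w → ∃ λ k → Walk G u w k

-- A cycle of length k+1 ≥ 3: distinct vertices f 0, …, f k, consecutive ones adjacent,
-- and f k adjacent to f 0.
record Cycle {n : ℕ} (G : Graph n) : Set where
  field
    k     : ℕ
    len   : 2 ≤ k
    f     : Fin (suc k) → Fin n
    inj   : Injective _≡_ _≡_ f
    step  : ∀ (i : Fin k) → Adj G (f (inject₁ i)) (f (suc i))
    close : Adj G (f (fromℕ k)) (f zero)

IsTree : ∀ {n} → Graph n → Set
IsTree G = Connected G × ¬ Cycle G

record Subgraph {m n : ℕ} (F : Graph m) (T : Graph n) : Set where
  field
    ι     : Fin m → Fin n
    ι-inj : Injective _≡_ _≡_ ι
    ι-adj : ∀ {x y} → Adj F x y → Adj T (ι x) (ι y)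

-- Packing colouring with colours {1,…,k}: class of colour i is an i-packing,
-- i.e. distinct vertices of colour i have distance > i (no walk of length ≤ i).
IsPackingColouring : ∀ {n} → Graph n → ℕ → (Fin n → ℕ) → Set
IsPackingColouring G k c =
  (∀ x → 1 ≤ c x × c x ≤ k) ×
  (∀ x y → x ≢ y → c x ≡ c y → ∀ l → Walk G x y l → c x < l)

Packable : ∀ {n} → Graph n → ℕ → Set
Packable G k = ∃ λ c → IsPackingColouring G k c

PackingChromaticNumber : ∀ {n} → Graph n → ℕ → Set
PackingChromaticNumber G k = Packable G k × (∀ j → j < k → ¬ Packable G j)

UniquelyPackable : ∀ {n} → Graph n → ℕ → Set
UniquelyPackable G k =
  PackingChromaticNumber G k ×
  (∀ c c' → IsPackingColouring G k c → IsPackingColouring G k c' → ∀ x → c x ≡ c' x)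

{-# OPTIONS --safe #-}
-- Colours repeat only beyond distance equal to the colour, so on a geodesic leaving a vertex of
-- colour 3 the next three vertices are forced to be coloured 1, 2, 1 and the fourth 3 again;
-- hence on every geodesic from such a vertex colour 3 sits exactly at the positions divisible by 4.
-- Restricting a packing colouring of T to F gives one of F, so by uniqueness ι v has colour 3.
-- Adjacency is not decidable, so distances in T are not found by search: every walk reduces to a
-- non-backtracking one, and in an acyclic graph all non-backtracking walks between two vertices
-- have the same length, since two of them leaving along different edges would close a cycle.
module Submission where

open import Defs
open import Data.Nat using (ℕ; zero; suc; _+_; _≤_; _<_; z≤n; s≤s)
open import Data.Nat.Properties
open import Data.Nat.Divisibility using (_∣_; _∣0; ∣-refl; ∣m∣n⇒∣m+n; ∣m+n∣m⇒∣n; >⇒∤)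
open import Data.Fin using (Fin; toℕ; inject₁; fromℕ)
open import Data.Fin.Properties using (toℕ-injective; toℕ<n; toℕ≤pred[n]; toℕ-inject₁; toℕ-fromℕ)
  renaming (_≟_ to _≟ᶠ_)
open import Data.Product using (∃; _×_; _,_; proj₁)
open import Data.Sum using (_⊎_; inj₁; inj₂)
open import Data.Empty using (⊥-elim)
open import Function.Bundles using (_⇔_; mk⇔; module Equivalence)
open import Relation.Nullary using (¬_; yes; no; contradiction)
open import Relation.Binary.PropositionalEquality
  using (_≡_; _≢_; refl; cong; subst; subst₂; trans) renaming (sym to ≡-sym)

Chain : ∀ {n} → Graph n → (ℕ → Fin n) → ℕ → Set
Chain G p k = ∀ i → i < k → Adj G (p i) (p (suc i))

module _ {n : ℕ} where

  NonBacktracking : (ℕ → Fin n) → ℕ → Set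
  NonBacktracking p k = ∀ i → 2 + i ≤ k → p i ≢ p (2 + i)

  InjectiveOn : (ℕ → Fin n) → ℕ → Set
  InjectiveOn p k = ∀ {i j} → i ≤ k → j ≤ k → p i ≡ p j → i ≡ j

  record NonBacktrackingWalk (G : Graph n) (u w : Fin n) (k : ℕ) : Set where
    field
      vertex          : ℕ → Fin n
      start           : vertex 0 ≡ u
      end             : vertex k ≡ w
      chain           : Chain G vertex k
      nonBacktracking : NonBacktracking vertex k

  nonBacktracking-restrict : ∀ {p k l} → k ≤ l → NonBacktracking p l → NonBacktracking p k
  nonBacktracking-restrict k≤l nb i 2+i≤k = nb i (≤-trans 2+i≤k k≤l)

  injectiveOn-drop : ∀ {p} i k → InjectiveOn p (i + k) → InjectiveOn (λ j → p (i + j)) k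
  injectiveOn-drop i k inj i≤k j≤k eq =
    +-cancelˡ-≡ i _ _ (inj (+-monoʳ-≤ i i≤k) (+-monoʳ-≤ i j≤k) eq)

  module _ {G : Graph n} where

    chain⇒walk : ∀ {p} k → Chain G p k → Walk G (p 0) (p k) k
    chain⇒walk zero    _     = nil
    chain⇒walk (suc k) chain = cons (chain 0 (s≤s z≤n)) (chain⇒walk k (λ i i<k → chain (suc i) (s≤s i<k)))

    chain-restrict : ∀ {p k l} → k ≤ l → Chain G p l → Chain G p k
    chain-restrict k≤l chain i i<k = chain i (≤-trans i<k k≤l)

    chain-drop : ∀ {p} i k → Chain G p (i + k) → Chain G (λ j → p (i + j)) k
    chain-drop {p} i k chain j j<k =
      subst (λ t → Adj G (p (i + j)) (p t)) (≡-sym (+-suc i j)) (chain (i + j) (+-monoʳ-< i j<k))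

    closed-chain⇒cycle : ∀ {p} h → Chain G p (3 + h) → InjectiveOn p (2 + h) → p 0 ≡ p (3 + h) → Cycle G
    closed-chain⇒cycle {p} h chain inj closed = record
      { k = 2 + h ; len = s≤s (s≤s z≤n) ; f = λ j → p (toℕ j)
      ; inj = λ {a} {b} eq → toℕ-injective (inj (toℕ≤pred[n] a) (toℕ≤pred[n] b) eq)
      ; step = step ; close = close }
      where
      step : ∀ (j : Fin (2 + h)) → Adj G (p (toℕ (inject₁ j))) (p (suc (toℕ j)))
      step j rewrite toℕ-inject₁ j = chain (toℕ j) (m≤n⇒m≤1+n (toℕ<n j))
      close : Adj G (p (toℕ (fromℕ (2 + h)))) (p 0)
      close rewrite toℕ-fromℕ (2 + h) = subst (Adj G (p (2 + h))) (≡-sym closed) (chain (2 + h) ≤-refl)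

    -- A first repeated vertex closes a cycle, of length at least 3 by irreflexivity and non-backtracking.
    acyclic-nonBacktracking⇒injectiveOn : ∀ {p k} → ¬ Cycle G → Chain G p k → NonBacktracking p k →
      InjectiveOn p k
    acyclic-nonBacktracking⇒injectiveOn {p} {k} acyclic chain nb = injectiveOn k ≤-refl
      where
      fresh : ∀ m → suc m ≤ k → InjectiveOn p m → ∀ {i} → i ≤ m → p i ≢ p (suc m)
      fresh m m<k inj {i} i≤m eq with m≤n⇒∃[o]m+o≡n i≤m
      ... | zero , refl rewrite +-identityʳ i = irrefl G (subst (Adj G (p i)) (≡-sym eq) (chain i m<k))
      ... | suc zero , refl rewrite +-comm i 1 = nb i m<k eq
      ... | suc (suc h) , refl = acyclic (closed-chain⇒cycle h
              (chain-drop i (3 + h) (chain-restrict (subst (_≤ k) (≡-sym (+-suc i (2 + h))) m<k) chain))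
              (injectiveOn-drop i (2 + h) inj)
              (trans (cong p (+-identityʳ i)) (trans eq (cong p (≡-sym (+-suc i (2 + h)))))))
      injectiveOn : ∀ m → m ≤ k → InjectiveOn p m
      injectiveOn zero _ z≤n z≤n _ = refl
      injectiveOn (suc m) m<k i≤ j≤ eq with m≤n⇒m<n∨m≡n i≤ | m≤n⇒m<n∨m≡n j≤
      ... | inj₁ (s≤s i≤m) | inj₁ (s≤s j≤m) = injectiveOn m (<⇒≤ m<k) i≤m j≤m eq
      ... | inj₂ refl      | inj₂ refl      = refl
      ... | inj₁ (s≤s i≤m) | inj₂ refl      = ⊥-elim (fresh m m<k (injectiveOn m (<⇒≤ m<k)) i≤m eq)
      ... | inj₂ refl      | inj₁ (s≤s j≤m) =
        ⊥-elim (fresh m m<k (injectiveOn m (<⇒≤ m<k)) j≤m (≡-sym eq))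

    -- The sequence p a, p (a ∸ 1), …, p 1, q 0, q 1, q 2, … ; it passes through p 0 when p 0 ≡ q 0.
    revAppend : (ℕ → Fin n) → ℕ → (ℕ → Fin n) → ℕ → Fin n
    revAppend p zero    q i       = q i
    revAppend p (suc a) q zero    = p (suc a)
    revAppend p (suc a) q (suc i) = revAppend p a q i

    module _ {p q : ℕ → Fin n} (p₀≡q₀ : p 0 ≡ q 0) where

      revAppend-start : ∀ a → revAppend p a q 0 ≡ p a
      revAppend-start zero    = ≡-sym p₀≡q₀
      revAppend-start (suc a) = refl

      revAppend-end : ∀ a j → revAppend p a q (a + j) ≡ q j
      revAppend-end zero    j = refl
      revAppend-end (suc a) j = revAppend-end a j

      revAppend-chain : ∀ {b} a → Chain G p a → Chain G q b → Chain G (revAppend p a q) (a + b)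
      revAppend-chain zero    _      chainQ = chainQ
      revAppend-chain (suc a) chainP chainQ zero _ =
        subst (Adj G (p (suc a))) (≡-sym (revAppend-start a)) (sym G (chainP a ≤-refl))
      revAppend-chain (suc a) chainP chainQ (suc i) (s≤s i<) =
        revAppend-chain a (chain-restrict (n≤1+n a) chainP) chainQ i i<

      revAppend-nonBacktracking : ∀ {b} → p 1 ≢ q 1 → ∀ a → NonBacktracking p a → NonBacktracking q b →
        NonBacktracking (revAppend p a q) (a + b)
      revAppend-nonBacktracking p₁≢q₁ zero          _   nbQ = nbQ
      revAppend-nonBacktracking p₁≢q₁ (suc zero)    _   _   zero _ = p₁≢q₁
      revAppend-nonBacktracking p₁≢q₁ (suc (suc a)) nbP _   zero _ eq =
        nbP a ≤-refl (≡-sym (trans eq (revAppend-start a)))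
      revAppend-nonBacktracking p₁≢q₁ (suc a)       nbP nbQ (suc i) (s≤s 2+i≤) =
        revAppend-nonBacktracking p₁≢q₁ a (nonBacktracking-restrict (n≤1+n a) nbP) nbQ i 2+i≤

    open NonBacktrackingWalk

    nbWalk⇒walk : ∀ {u w k} → NonBacktrackingWalk G u w k → Walk G u w k
    nbWalk⇒walk {k = k} P = subst₂ (λ x y → Walk G x y k) (start P) (end P) (chain⇒walk k (chain P))

    stay : ∀ {u} → NonBacktrackingWalk G u u 0
    stay {u} = record { vertex = λ _ → u ; start = refl ; end = refl ; chain = λ _ () ; nonBacktracking = λ _ () }

    prepend : ∀ {x y w k} → Adj G x y → (P : NonBacktrackingWalk G y w k) → (1 ≤ k → x ≢ vertex P 1) →
      NonBacktrackingWalk G x w (suc k)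
    prepend {x} {k = k} x~y P x≢P₁ = record
      { vertex = vertex′ ; start = refl ; end = end P ; chain = chain′ ; nonBacktracking = nonBacktracking′ }
      where
      vertex′ : ℕ → Fin n
      vertex′ zero    = x
      vertex′ (suc i) = vertex P i
      chain′ : Chain G vertex′ (suc k)
      chain′ zero    _       = subst (Adj G x) (≡-sym (start P)) x~y
      chain′ (suc i) (s≤s i<k) = chain P i i<k
      nonBacktracking′ : NonBacktracking vertex′ (suc k)
      nonBacktracking′ zero    (s≤s 1≤k) = x≢P₁ 1≤k
      nonBacktracking′ (suc i) (s≤s 2+i≤k) = nonBacktracking P i 2+i≤k

    dropFirst : ∀ {u w k y} → (P : NonBacktrackingWalk G u w (suc k)) → vertex P 1 ≡ y →
      NonBacktrackingWalk G y w k
    dropFirst P P₁≡y = record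
      { vertex = λ i → vertex P (suc i) ; start = P₁≡y ; end = end P
      ; chain = λ i i<k → chain P (suc i) (s≤s i<k)
      ; nonBacktracking = λ i 2+i≤k → nonBacktracking P (suc i) (s≤s 2+i≤k) }

    walk⇒nbWalk : ∀ {u w l} → Walk G u w l → ∃ λ k → k ≤ l × NonBacktrackingWalk G u w k
    walk⇒nbWalk nil = 0 , z≤n , stay
    walk⇒nbWalk {u = x} (cons x~y W) with walk⇒nbWalk W
    ... | zero  , _   , P = 1 , s≤s z≤n , prepend x~y P (λ ())
    ... | suc k , k<l , P with vertex P 1 ≟ᶠ x
    ...   | yes P₁≡x = k , m≤n⇒m≤1+n (<⇒≤ k<l) , dropFirst P P₁≡x
    ...   | no  P₁≢x = suc (suc k) , s≤s k<l , prepend x~y P (λ _ x≡P₁ → P₁≢x (≡-sym x≡P₁))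

    revAppend-walk : ∀ {u w w′ a b} (P : NonBacktrackingWalk G u w a) (Q : NonBacktrackingWalk G u w′ b) →
      vertex P 1 ≢ vertex Q 1 → NonBacktrackingWalk G w w′ (a + b)
    revAppend-walk {a = a} {b} P Q P₁≢Q₁ = record
      { vertex          = revAppend (vertex P) a (vertex Q)
      ; start           = trans (revAppend-start P₀≡Q₀ a) (end P)
      ; end             = trans (revAppend-end P₀≡Q₀ a b) (end Q)
      ; chain           = revAppend-chain P₀≡Q₀ a (chain P) (chain Q)
      ; nonBacktracking = revAppend-nonBacktracking P₀≡Q₀ P₁≢Q₁ a (nonBacktracking P) (nonBacktracking Q) }
      where
      P₀≡Q₀ : vertex P 0 ≡ vertex Q 0
      P₀≡Q₀ = trans (start P) (≡-sym (start Q))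

    module _ (acyclic : ¬ Cycle G) where

      closed-nbWalk-length : ∀ {u k} → NonBacktrackingWalk G u u k → k ≡ 0
      closed-nbWalk-length P = ≡-sym (acyclic-nonBacktracking⇒injectiveOn acyclic (chain P) (nonBacktracking P)
        z≤n ≤-refl (trans (start P) (≡-sym (end P))))

      -- Walks leaving u along different edges glue, through u, into a closed non-backtracking walk from w.
      nbWalk-length-unique : ∀ {u w a b} → NonBacktrackingWalk G u w a → NonBacktrackingWalk G u w b → a ≡ b
      nbWalk-length-unique {a = zero}  {zero}  P Q = refl
      nbWalk-length-unique {a = zero}  {suc b} P Q =
        ⊥-elim (1+n≢0 (closed-nbWalk-length
          (subst (λ t → NonBacktrackingWalk G _ t (suc b)) (trans (≡-sym (end P)) (start P)) Q)))
      nbWalk-length-unique {a = suc a} {zero}  P Q =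
        ⊥-elim (1+n≢0 (closed-nbWalk-length
          (subst (λ t → NonBacktrackingWalk G _ t (suc a)) (trans (≡-sym (end Q)) (start Q)) P)))
      nbWalk-length-unique {a = suc a} {suc b} P Q with vertex P 1 ≟ᶠ vertex Q 1
      ... | yes P₁≡Q₁ = cong suc (nbWalk-length-unique (dropFirst P P₁≡Q₁) (dropFirst Q refl))
      ... | no  P₁≢Q₁ = ⊥-elim (1+n≢0 (closed-nbWalk-length (revAppend-walk P Q P₁≢Q₁)))

      nbWalk⇒dist : ∀ {u w k} → NonBacktrackingWalk G u w k → Dist G u w k
      nbWalk⇒dist P = nbWalk⇒walk P , λ l W →
        let k′ , k′≤l , Q = walk⇒nbWalk W in subst (_≤ l) (≡-sym (nbWalk-length-unique P Q)) k′≤l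

    tree⇒∃dist : IsTree G → ∀ u w → ∃ λ d → Dist G u w d
    tree⇒∃dist (connected , acyclic) u w =
      let _ , W = connected u w ; d , _ , P = walk⇒nbWalk W in d , nbWalk⇒dist acyclic P

    _++ʷ_ : ∀ {x y z a b} → Walk G x y a → Walk G y z b → Walk G x z (a + b)
    nil         ++ʷ V = V
    cons x~y W ++ʷ V = cons x~y (W ++ʷ V)

    dist-prefix : ∀ {u y w a b} → Walk G u y a → Walk G y w b → Dist G u w (a + b) → Dist G u y a
    dist-prefix {a = a} {b} W V (_ , shortest) = W , λ k W′ → +-cancelʳ-≤ b a k (shortest (k + b) (W′ ++ʷ V))

    dist-suffix : ∀ {u y w a b} → Walk G u y a → Walk G y w b → Dist G u w (a + b) → Dist G y w b
    dist-suffix {a = a} {b} W V (_ , shortest) = V , λ k V′ → +-cancelˡ-≤ a b k (shortest (a + k) (W ++ʷ V′))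

    dist-suc⇒≢ : ∀ {x y t} → Dist G x y (suc t) → x ≢ y
    dist-suc⇒≢ (_ , shortest) refl with () ← shortest 0 nil

    packing-apart : ∀ {k c x y t i} → IsPackingColouring G k c → Dist G x y (suc t) →
      c x ≡ i → c y ≡ i → i ≤ t
    packing-apart (_ , packing) D@(W , _) refl cy≡cx = ≤-pred (packing _ _ (dist-suc⇒≢ D) (≡-sym cy≡cx) _ W)

module PackingColouring3 {n} {G : Graph n} {c : Fin n → ℕ} (packing : IsPackingColouring G 3 c) where

  apart : ∀ {x y t i} → Dist G x y (suc t) → c x ≡ i → c y ≡ i → i ≤ t
  apart = packing-apart packing

  colour-cases : ∀ x → c x ≡ 1 ⊎ c x ≡ 2 ⊎ c x ≡ 3
  colour-cases x with c x | proj₁ packing x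
  ... | 1 | _ = inj₁ refl
  ... | 2 | _ = inj₂ (inj₁ refl)
  ... | 3 | _ = inj₂ (inj₂ refl)
  ... | 0 | () , _
  ... | suc (suc (suc (suc _))) | _ , s≤s (s≤s (s≤s ()))

  colour≢3-cases : ∀ x → c x ≢ 3 → c x ≡ 1 ⊎ c x ≡ 2
  colour≢3-cases x x≢3 with colour-cases x
  ... | inj₁ x1        = inj₁ x1
  ... | inj₂ (inj₁ x2) = inj₂ x2
  ... | inj₂ (inj₂ x3) = ⊥-elim (x≢3 x3)

  colours-121 : ∀ {x y z} → Dist G x y 1 → Dist G y z 1 → Dist G x z 2 →
    c x ≢ 3 → c y ≢ 3 → c z ≢ 3 → c y ≡ 2 × c z ≡ 1
  colours-121 {x} {y} {z} Dxy Dyz Dxz x≢3 y≢3 z≢3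
    with colour≢3-cases x x≢3 | colour≢3-cases y y≢3 | colour≢3-cases z z≢3
  ... | _       | inj₂ y2 | inj₁ z1 = y2 , z1
  ... | _       | inj₁ y1 | inj₁ z1 = contradiction (apart Dyz y1 z1) λ ()
  ... | _       | inj₂ y2 | inj₂ z2 = contradiction (apart Dyz y2 z2) λ ()
  ... | inj₁ x1 | inj₁ y1 | inj₂ _  = contradiction (apart Dxy x1 y1) λ ()
  ... | inj₂ x2 | inj₁ _  | inj₂ z2 = contradiction (apart Dxz x2 z2) λ { (s≤s ()) }

  colour3-near : ∀ {u y t} → c u ≡ 3 → t ≤ 2 → Dist G u y (suc t) → c y ≢ 3
  colour3-near u3 t≤2 D y3 = ≤⇒≯ t≤2 (apart D u3 y3)

  colour3⇔4∣dist-near : ∀ {u y t} → c u ≡ 3 → t ≤ 2 → Dist G u y (suc t) → c y ≡ 3 ⇔ 4 ∣ suc t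
  colour3⇔4∣dist-near u3 t≤2 D =
    mk⇔ (λ y3 → contradiction y3 (colour3-near u3 t≤2 D))
        (λ 4∣ → contradiction 4∣ (>⇒∤ (s≤s (s≤s t≤2))))

  -- Along a geodesic u, p₁, p₂, p₃, w from colour 3 the colours are forced to be 3, 1, 2, 1, 3.
  colour3-period : ∀ {u w} → c u ≡ 3 → Dist G u w 4 → c w ≡ 3
  colour3-period {u} {w} u3 D@(cons a₁ (cons {y = p₂} a₂ (cons {y = p₃} a₃ (cons a₄ nil))) , _) =
    last (colours-121 D₁₂ D₂₃ D₁₃
      (colour3-near u3 z≤n D₀₁) (colour3-near u3 (s≤s z≤n) D₀₂)
      (colour3-near u3 (s≤s (s≤s z≤n)) D₀₃))
    where
    edge : ∀ {x y} → Adj G x y → Walk G x y 1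
    edge x~y = cons x~y nil
    D₀₁ = dist-prefix (edge a₁) (cons a₂ (cons a₃ (edge a₄))) D
    D₀₂ = dist-prefix (cons a₁ (edge a₂)) (cons a₃ (edge a₄)) D
    D₀₃ = dist-prefix (cons a₁ (cons a₂ (edge a₃))) (edge a₄) D
    D₁₄ = dist-suffix (edge a₁) (cons a₂ (cons a₃ (edge a₄))) D
    D₁₃ = dist-prefix (cons a₂ (edge a₃)) (edge a₄) D₁₄
    D₁₂ = dist-prefix (edge a₂) (edge a₃) D₁₃
    D₂₃ = dist-suffix (edge a₂) (edge a₃) D₁₃
    D₂₄ = dist-suffix (cons a₁ (edge a₂)) (cons a₃ (edge a₄)) D
    D₃₄ = dist-suffix (cons a₁ (cons a₂ (edge a₃))) (edge a₄) D
    last : c p₂ ≡ 2 × c p₃ ≡ 1 → c w ≡ 3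
    last (p₂2 , p₃1) with colour-cases w
    ... | inj₂ (inj₂ w3) = w3
    ... | inj₁ w1        = contradiction (apart D₃₄ p₃1 w1) λ ()
    ... | inj₂ (inj₁ w2) = contradiction (apart D₂₄ p₂2 w2) λ { (s≤s ()) }

  colour3⇔4∣dist : ∀ {u x} → c u ≡ 3 → ∀ d → Dist G u x d → c x ≡ 3 ⇔ 4 ∣ d
  colour3⇔4∣dist u3 0 (nil , _) = mk⇔ (λ _ → 4 ∣0) (λ _ → u3)
  colour3⇔4∣dist u3 1 D = colour3⇔4∣dist-near u3 z≤n D
  colour3⇔4∣dist u3 2 D = colour3⇔4∣dist-near u3 (s≤s z≤n) D
  colour3⇔4∣dist u3 3 D = colour3⇔4∣dist-near u3 (s≤s (s≤s z≤n)) D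
  colour3⇔4∣dist u3 (suc (suc (suc (suc d)))) D@(cons a₁ (cons a₂ (cons a₃ (cons a₄ W))) , _) =
    mk⇔ (λ x3 → ∣m∣n⇒∣m+n ∣-refl (to x3)) (λ 4∣4+d → from (∣m+n∣m⇒∣n 4∣4+d ∣-refl))
    where
    W₄ = cons a₁ (cons a₂ (cons a₃ (cons a₄ nil)))
    open Equivalence (colour3⇔4∣dist (colour3-period u3 (dist-prefix W₄ W D)) d (dist-suffix W₄ W D))

map-walk : ∀ {m n} {F : Graph m} {T : Graph n} (S : Subgraph F T) {x y k} →
  Walk F x y k → Walk T (Subgraph.ι S x) (Subgraph.ι S y) k
map-walk S nil           = nil
map-walk S (cons x~y W) = cons (Subgraph.ι-adj S x~y) (map-walk S W)

packing-restrict : ∀ {m n} {F : Graph m} {T : Graph n} (S : Subgraph F T) {k c} →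
  IsPackingColouring T k c → IsPackingColouring F k (λ x → c (Subgraph.ι S x))
packing-restrict S (range , packing) =
  (λ x → range (Subgraph.ι S x)) ,
  λ x y x≢y cx≡cy l W →
    packing _ _ (λ ιx≡ιy → x≢y (Subgraph.ι-inj S ιx≡ιy)) cx≡cy l (map-walk S W)

lemma2p5 : ∀ {m n} (F : Graph m) (T : Graph n) → IsTree F → IsTree T →
    (S : Subgraph F T) → UniquelyPackable F 3 →
    (c₀ : Fin m → ℕ) → IsPackingColouring F 3 c₀ →
    (v : Fin m) → c₀ v ≡ 3 →
    (c : Fin n → ℕ) → IsPackingColouring T 3 c →
    ∀ x → (c x ≡ 3) ⇔ (∃ λ d → Dist T (Subgraph.ι S v) x d × 4 ∣ d)
-- F need not be a tree: only the uniqueness of its packing colouring is used.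
lemma2p5 _ _ _ treeT S (_ , unique) c₀ c₀-packing v v3 c c-packing x =
  mk⇔ (λ x3 → let d , D = tree⇒∃dist treeT u x in d , D , Equivalence.to (colour3⇔4∣dist u3 d D) x3)
      (λ { (d , D , 4∣d) → Equivalence.from (colour3⇔4∣dist u3 d D) 4∣d })
  where
  open PackingColouring3 c-packing
  u = Subgraph.ι S v
  u3 : c u ≡ 3
  u3 = trans (≡-sym (unique c₀ _ c₀-packing (packing-restrict S c-packing) v)) v3
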